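{- Let $a\ge0$ be an integer and $\mathbf{x}\in\mathcal{X}_F$. If $10^a10^{a+1}1$ or $10^{a+1}10^a1$ is a factor of $\mathbf{x}$, then $\mathbf{x}\in(1(0^a+0^{a+1}))^{\mathbb{Z}}$, i.e.\ $\mathbf{x}$ is a bi-infinite concatenation of the blocks $10^a$ and $10^{a+1}$.
   Context: Let $\mathcal{A}=\{0,1\}$. For a finite word $v=v_1\cdots v_n$ over $\mathcal{A}$, $\tilde v=v_n\cdots v_1$ is its mirror word (with $\tilde\lambda=\lambda$ for the empty word), and $0^k$ denotes the word of $k$ zeros. Let $F=\{0v01\tilde v1,\ 1\tilde v10v0 : v\in\mathcal{A}^*\}$, and let $\mathcal{X}_F$ be the set of bi-infinite words $\mathbf{x}\in\mathcal{A}^{\mathbb{Z}}$ none of whose finite factors belongs to $F$. -}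

module Defs where

open import Data.Nat using (ℕ; suc)
open import Data.Integer using (ℤ; +_; _+_; 1ℤ)
open import Data.List using (List; []; _∷_; _++_; [_]; reverse; replicate; length)
open import Data.Product using (Σ; ∃; _×_)
open import Data.Sum using (_⊎_)
open import Data.Unit using (⊤)
open import Relation.Binary.PropositionalEquality using (_≡_)
open import Relation.Nullary using (¬_)

-- The alphabet A = {0,1}: O stands for 0, I stands for 1.
data Letter : Set where
  O I : Letter

Word : Set
Word = List Letter

mirror : Word → Word
mirror = reverse

zeros : ℕ → Word
zeros k = replicate k O

BiWord : Set
BiWord = ℤ → Letter

OccursAt : BiWord → ℤ → Word → Set
OccursAt x i [] = ⊤
OccursAt x i (c ∷ w) = (x i ≡ c) × OccursAt x (i + 1ℤ) w

IsFactor : Word → BiWord → Set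
IsFactor w x = ∃ λ i → OccursAt x i w

InF : Word → Set
InF w = ∃ λ (v : Word) →
  (w ≡ O ∷ v ++ O ∷ I ∷ mirror v ++ [ I ]) ⊎
  (w ≡ I ∷ mirror v ++ I ∷ O ∷ v ++ [ O ])

InXF : BiWord → Set
InXF x = ∀ w → IsFactor w x → ¬ InF w

-- Blocks are indexed by n ∈ ℤ; block n
-- starts at position p n, has one of the two shapes, and block n+1
-- starts right after it.  (Since every block has length ≥ 1, the
-- positions p n tend to ±∞, so the blocks tile all of ℤ.)
IsConcatOfBlocks : ℕ → BiWord → Set
IsConcatOfBlocks a x = Σ (ℤ → ℤ) λ p → ∀ (n : ℤ) →
  (OccursAt x (p n) (I ∷ zeros a) × p (n + 1ℤ) ≡ p n + + suc a) ⊎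
  (OccursAt x (p n) (I ∷ zeros (suc a)) × p (n + 1ℤ) ≡ p n + + suc (suc a))

-- Read x outwards from a 1 that has a 0 next to it: l is the word on one
-- side of the 1, and r the word beyond the 0 on the other side.  If l beats r
-- at their first difference, with a 1 against a 0 (l ≻ r), then the mirrored
-- prefixes form a word 1ṽ10v0 ∈ F or its reverse, so avoiding F forbids l ≻ r.
--
-- Cut the word around a 1 into blocks 0^g 1.  Starting from the given factor,
-- grow a window of blocks with gaps a and a + 1 around its middle 1,
-- alternately to the right and to the left so that both halves keep the same
-- length.  Seen from the end being grown, the window begins with a run of
-- k + 1 equal blocks, then one of the other kind, then at least k more blocks.
-- If the next gap were below a or at least a + 2, comparing the readings at
-- that end, at the 1 closing the run and at the 1 after it produces some l ≻ r.
-- So every gap is a or a + 1, and the window exhausts ℤ.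

module Submission where

open import Defs
open import Data.Nat using (ℕ; suc)
open import Data.List using (_∷_; _++_; [_])
open import Data.Sum using (_⊎_)

open import Data.Nat using (zero; _≤_; _<_; z≤n; s≤s)
import Data.Nat.Properties as ℕₚ
open import Data.Integer using (ℤ; +_; -[1+_]; _+_; 1ℤ; -1ℤ)
import Data.Integer.Properties as ℤₚ
open import Data.List using (List; []; reverse; replicate; length; _∷ʳ_)
open import Data.List.Properties
  using (++-assoc; ++-identityʳ; reverse-++; unfold-reverse; ∷ʳ-++;
         length-replicate; length-reverse; length-++-≤ˡ; length-++-≤ʳ; length-++-sucʳ)
open import Data.Product using (∃; _×_; _,_; proj₁; proj₂; map₁; map₂)
open import Data.Sum using (inj₁; inj₂)
open import Data.Unit using (tt)
open import Data.Empty using (⊥-elim)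
open import Function using (_∘_)
open import Relation.Binary.Definitions using (tri<; tri≈; tri>)
open import Relation.Binary.PropositionalEquality
  using (_≡_; _≢_; refl; sym; trans; cong; cong₂; subst; subst₂; ≢-sym; module ≡-Reasoning)
open import Relation.Nullary using (¬_)

private
  variable
    A : Set
    x : BiWord
    i j q : ℤ
    c : Letter
    u v w l r t : Word

replicate-∷ʳ : ∀ n (a : A) → replicate n a ∷ʳ a ≡ a ∷ replicate n a
replicate-∷ʳ zero    a = refl
replicate-∷ʳ (suc n) a = cong (a ∷_) (replicate-∷ʳ n a)

reverse-replicate : ∀ n (a : A) → reverse (replicate n a) ≡ replicate n a
reverse-replicate zero    a = refl
reverse-replicate (suc n) a = begin
  reverse (replicate (suc n) a)  ≡⟨ unfold-reverse a (replicate n a) ⟩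
  reverse (replicate n a) ∷ʳ a   ≡⟨ cong (_∷ʳ a) (reverse-replicate n a) ⟩
  replicate n a ∷ʳ a             ≡⟨ replicate-∷ʳ n a ⟩
  replicate (suc n) a            ∎
  where open ≡-Reasoning

length-∷ʳ : ∀ (xs : List A) a → length (xs ∷ʳ a) ≡ suc (length xs)
length-∷ʳ xs a = trans (length-++-sucʳ xs a []) (cong (suc ∘ length) (++-identityʳ xs))

-- Reading a bi-infinite word in either direction

data Direction : Set where
  leftward rightward : Direction

opposite : Direction → Direction
opposite leftward  = rightward
opposite rightward = leftward

step : Direction → ℤ
step leftward  = -1ℤ
step rightward = 1ℤ

shift : Direction → ℕ → ℤ → ℤ
shift d zero    i = i
shift d (suc n) i = shift d n (i + step d)

private
  variable
    d : Direction

data Reads (x : BiWord) (d : Direction) : ℤ → Word → Set where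
  []  : Reads x d i []
  _∷_ : x i ≡ c → Reads x d (i + step d) w → Reads x d i (c ∷ w)

head : Reads x d i (c ∷ w) → x i ≡ c
head (e ∷ _) = e

reads-resp : i ≡ j → Reads x d i w → Reads x d j w
reads-resp refl r = r

reads-++⁻ : ∀ u → Reads x d i (u ++ v) → Reads x d i u × Reads x d (shift d (length u) i) v
reads-++⁻ []      r       = [] , r
reads-++⁻ (c ∷ u) (e ∷ r) = map₁ (e ∷_) (reads-++⁻ u r)

reads-++⁺ : ∀ u → Reads x d i u → Reads x d (shift d (length u) i) v → Reads x d i (u ++ v)
reads-++⁺ []      []       r = r
reads-++⁺ (c ∷ u) (e ∷ r₁) r = e ∷ reads-++⁺ u r₁ r

reads-prefix : ∀ u → Reads x d i (u ++ v) → Reads x d i u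
reads-prefix u = proj₁ ∘ reads-++⁻ u

reads-at : ∀ u → Reads x d i (u ++ c ∷ w) → x (shift d (length u) i) ≡ c
reads-at u = head ∘ proj₂ ∘ reads-++⁻ u

reads⇒occursAt : Reads x rightward i w → OccursAt x i w
reads⇒occursAt []      = tt
reads⇒occursAt (e ∷ r) = e , reads⇒occursAt r

occursAt⇒reads : ∀ x w → OccursAt x i w → Reads x rightward i w
occursAt⇒reads x []      _       = []
occursAt⇒reads x (c ∷ w) (e , o) = e ∷ occursAt⇒reads x w o

scan-zeros : ∀ x d m i → (∃ λ g → g < m × Reads x d i (zeros g ++ [ I ])) ⊎ Reads x d i (zeros m)
scan-zeros x d zero    i = inj₂ []
scan-zeros x d (suc m) i with x i in e
... | I = inj₁ (0 , s≤s z≤n , e ∷ [])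
... | O with scan-zeros x d m (i + step d)
...   | inj₁ (g , g<m , r) = inj₁ (suc g , s≤s g<m , e ∷ r)
...   | inj₂ r             = inj₂ (e ∷ r)

step-opposite : ∀ d i → i + step d + step (opposite d) ≡ i
step-opposite leftward  i = trans (ℤₚ.+-assoc i -1ℤ 1ℤ) (ℤₚ.+-identityʳ i)
step-opposite rightward i = trans (ℤₚ.+-assoc i 1ℤ -1ℤ) (ℤₚ.+-identityʳ i)

shift-suc : ∀ d n i → shift d (suc n) i ≡ shift d n i + step d
shift-suc d zero    i = refl
shift-suc d (suc n) i = shift-suc d n (i + step d)

shift-opposite : ∀ d n i → shift (opposite d) n (shift d n i) ≡ i
shift-opposite d zero    i = refl
shift-opposite d (suc n) i = begin
  shift (opposite d) n (shift d (suc n) i + step (opposite d))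
    ≡⟨ cong (λ k → shift (opposite d) n (k + step (opposite d))) (shift-suc d n i) ⟩
  shift (opposite d) n (shift d n i + step d + step (opposite d))
    ≡⟨ cong (shift (opposite d) n) (step-opposite d (shift d n i)) ⟩
  shift (opposite d) n (shift d n i)
    ≡⟨ shift-opposite d n i ⟩
  i ∎
  where open ≡-Reasoning

shift-rightward : ∀ n i → shift rightward n i ≡ i + + n
shift-rightward zero    i = sym (ℤₚ.+-identityʳ i)
shift-rightward (suc n) i = begin
  shift rightward n (i + 1ℤ)  ≡⟨ shift-rightward n (i + 1ℤ) ⟩
  i + 1ℤ + + n                ≡⟨ ℤₚ.+-assoc i 1ℤ (+ n) ⟩
  i + (1ℤ + + n)              ≡⟨ cong (λ k → i + k) (sym (ℤₚ.pos-+ 1 n)) ⟩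
  i + + suc n                 ∎
  where open ≡-Reasoning

splice : ∀ u → Reads x d i (c ∷ u) → Reads x (opposite d) i (c ∷ v) →
  Reads x (opposite d) (shift d (length u) i) (reverse u ++ c ∷ v)
splice []       _             r = r
splice {x = x} {d = d} {i = i} {c = c} {v = v} (c′ ∷ u) (_ ∷ l) r =
  subst (Reads x (opposite d) _) (sym regroup)
    (splice u l (head l ∷ reads-resp (sym (step-opposite d i)) r))
  where
  regroup : reverse (c′ ∷ u) ++ c ∷ v ≡ reverse u ++ c′ ∷ c ∷ v
  regroup = trans (cong (_++ c ∷ v) (unfold-reverse c′ u)) (∷ʳ-++ (reverse u) c′ (c ∷ v))

splice′ : ∀ u → Reads x (opposite d) i (c ∷ u) → Reads x d i (c ∷ v) →
  Reads x d (shift (opposite d) (length u) i) (reverse u ++ c ∷ v)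
splice′ {d = leftward}  = splice {d = rightward}
splice′ {d = rightward} = splice {d = leftward}

-- What avoiding F forbids

reverse-F-shape : ∀ (p q r s : Letter) u u′ →
  reverse (p ∷ u ++ q ∷ r ∷ u′ ++ [ s ]) ≡ s ∷ reverse u′ ++ r ∷ q ∷ reverse u ++ [ p ]
reverse-F-shape p q r s u u′ = begin
  reverse ((p ∷ u) ++ (q ∷ r ∷ []) ++ (u′ ++ [ s ]))
    ≡⟨ reverse-++ (p ∷ u) ((q ∷ r ∷ []) ++ (u′ ++ [ s ])) ⟩
  reverse ((q ∷ r ∷ []) ++ (u′ ++ [ s ])) ++ reverse (p ∷ u)
    ≡⟨ cong₂ _++_ (trans (reverse-++ (q ∷ r ∷ []) (u′ ++ [ s ]))
                         (cong (_++ r ∷ q ∷ []) (reverse-++ u′ [ s ])))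
                  (unfold-reverse p u) ⟩
  ((s ∷ reverse u′) ++ r ∷ q ∷ []) ++ (reverse u ++ [ p ])
    ≡⟨ ++-assoc (s ∷ reverse u′) (r ∷ q ∷ []) (reverse u ++ [ p ]) ⟩
  s ∷ reverse u′ ++ r ∷ q ∷ reverse u ++ [ p ] ∎
  where open ≡-Reasoning

InF-reverse : InF w → InF (reverse w)
InF-reverse (v , inj₁ refl) = reverse v , inj₂ (reverse-F-shape O O I I v (reverse v))
InF-reverse (v , inj₂ refl) = reverse v , inj₁ (reverse-F-shape I I O O (reverse v) v)

reads-∉F : InXF x → Reads x d i w → ¬ InF w
reads-∉F {d = rightward} xf r = xf _ (_ , reads⇒occursAt r)
reads-∉F {d = leftward} xf [] (_ , inj₁ ())
reads-∉F {d = leftward} xf [] (_ , inj₂ ())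
reads-∉F {x = x} {d = leftward} {w = c ∷ u} xf r w∈F =
  xf (reverse (c ∷ u)) (_ , reads⇒occursAt backwards) (InF-reverse w∈F)
  where
  backwards : Reads x rightward _ (reverse (c ∷ u))
  backwards = subst (Reads x rightward _) (sym (unfold-reverse c u)) (splice u r (head r ∷ []))

-- l ≻ r: at the first position where l and r differ, l has 1 and r has 0
-- (a word that is a proper prefix of the other does not count).
infix 4 _≻_
data _≻_ : Word → Word → Set where
  here  : (I ∷ l) ≻ (O ∷ r)
  there : l ≻ r → (c ∷ l) ≻ (c ∷ r)

≻-split : l ≻ r → ∃ λ w → ∃ λ l′ → ∃ λ r′ → l ≡ (w ++ [ I ]) ++ l′ × r ≡ (w ++ [ O ]) ++ r′
≻-split (here {l} {r}) = [] , l , r , refl , refl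
≻-split (there {c = c} l≻r) with ≻-split l≻r
... | w , l′ , r′ , refl , refl = c ∷ w , l′ , r′ , refl , refl

≻-++ : ∀ w → l ≻ r → (w ++ l) ≻ (w ++ r)
≻-++ []      l≻r = l≻r
≻-++ (c ∷ w) l≻r = there (≻-++ w l≻r)

zeros-≻ : ∀ {g h} → g < h → (zeros g ++ I ∷ l) ≻ (zeros h ++ r)
zeros-≻ {g = zero}  {suc h} _         = here
zeros-≻ {g = suc g} {suc h} (s≤s g<h) = there (zeros-≻ g<h)

zeros-≻-zeros : ∀ {g h} → g < h → (zeros g ++ I ∷ l) ≻ zeros h
zeros-≻-zeros {g = zero}  {suc h} _         = here
zeros-≻-zeros {g = suc g} {suc h} (s≤s g<h) = there (zeros-≻-zeros g<h)

forbidden : InXF x → Reads x d i (I ∷ l) → Reads x (opposite d) i (I ∷ O ∷ r) → ¬ l ≻ r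
forbidden {x = x} {d = d} xf ls rs l≻r with ≻-split l≻r
... | w , _ , _ , refl , refl = reads-∉F xf mirrored (w , inj₂ refl)
  where
  mirrored : Reads x (opposite d) _ (I ∷ reverse w ++ I ∷ O ∷ w ++ [ O ])
  mirrored = subst (Reads x (opposite d) _) (cong (_++ I ∷ O ∷ w ++ [ O ]) (reverse-++ w [ I ]))
               (splice (w ++ [ I ]) (reads-prefix (I ∷ w ++ [ I ]) ls) (reads-prefix (I ∷ O ∷ w ++ [ O ]) rs))

forbidden′ : InXF x → Reads x (opposite d) i (I ∷ l) → Reads x d i (I ∷ O ∷ r) → ¬ l ≻ r
forbidden′ {d = leftward}  = forbidden {d = rightward}
forbidden′ {d = rightward} = forbidden {d = leftward}

-- Runs of blocks

data Block : Set where
  short long : Block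

other : Block → Block
other short = long
other long  = short

≢⇒≡other : ∀ {b b′} → b ≢ b′ → b′ ≡ other b
≢⇒≡other {short} {short} b≢b′ = ⊥-elim (b≢b′ refl)
≢⇒≡other {short} {long}  _    = refl
≢⇒≡other {long}  {short} _    = refl
≢⇒≡other {long}  {long}  b≢b′ = ⊥-elim (b≢b′ refl)

EarlyChange : List Block → Set
EarlyChange L = ∃ λ b → ∃ λ k → ∃ λ R → L ≡ replicate (suc k) b ++ other b ∷ R × k ≤ length R

private
  FirstRun : List Block → ℕ → ℕ → Set
  FirstRun L m n = ∃ λ b → ∃ λ k → ∃ λ R → L ≡ replicate (suc k) b ++ other b ∷ R × k ≤ m × n ≤ length R

  first-run-∷ : ∀ b′ b k R → FirstRun (b′ ∷ replicate (suc k) b ++ other b ∷ R) (suc k) (length R)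
  first-run-∷ short short k R = short , suc k , R , refl , ℕₚ.≤-refl , ℕₚ.≤-refl
  first-run-∷ long  long  k R = long  , suc k , R , refl , ℕₚ.≤-refl , ℕₚ.≤-refl
  first-run-∷ short long  k R = short , 0 , replicate k long ++ short ∷ R , refl , z≤n ,
    ℕₚ.≤-trans (ℕₚ.n≤1+n _) (length-++-≤ʳ (short ∷ R) {replicate k long})
  first-run-∷ long  short k R = long  , 0 , replicate k short ++ long ∷ R , refl , z≤n ,
    ℕₚ.≤-trans (ℕₚ.n≤1+n _) (length-++-≤ʳ (long ∷ R) {replicate k short})

  first-run : ∀ P {b b′} S → b ≢ b′ → FirstRun (P ++ b ∷ b′ ∷ S) (length P) (length S)
  first-run [] {b} S b≢b′ = b , 0 , S , cong (λ b″ → b ∷ b″ ∷ S) (≢⇒≡other b≢b′) , z≤n , ℕₚ.≤-refl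
  first-run (b″ ∷ P) S b≢b′ with first-run P S b≢b′
  ... | b , k , R , eq , k≤P , S≤R with first-run-∷ b″ b k R
  ...   | b₁ , k₁ , R₁ , eq₁ , k₁≤ , R≤R₁ =
    b₁ , k₁ , R₁ , trans (cong (b″ ∷_) eq) eq₁ , ℕₚ.≤-trans k₁≤ (s≤s k≤P) , ℕₚ.≤-trans S≤R R≤R₁

earlyChange : ∀ P {b b′} S → b ≢ b′ → length P ≤ length S → EarlyChange (P ++ b ∷ b′ ∷ S)
earlyChange P S b≢b′ P≤S with first-run P S b≢b′
... | b , k , R , eq , k≤P , S≤R = b , k , R , eq , ℕₚ.≤-trans k≤P (ℕₚ.≤-trans P≤S S≤R)

-- Tilings by blocks with gaps a and a + 1

module Tiling (a : ℕ) where

  gap : Block → ℕ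
  gap short = a
  gap long  = suc a

  gap<2+a : ∀ b → gap b < suc (suc a)
  gap<2+a short = ℕₚ.m<n⇒m<1+n (ℕₚ.n<1+n a)
  gap<2+a long  = ℕₚ.n<1+n (suc a)

  blocks : List Block → Word → Word
  blocks []      t = t
  blocks (b ∷ L) t = zeros (gap b) ++ I ∷ blocks L t

  overlong : Word
  overlong = zeros (suc (suc a))

  blocks-++ : ∀ L M t → blocks (L ++ M) t ≡ blocks L (blocks M t)
  blocks-++ []      M t = refl
  blocks-++ (b ∷ L) M t = cong (λ w → zeros (gap b) ++ I ∷ w) (blocks-++ L M t)

  blocks-tail : ∀ L t → blocks L t ≡ blocks L [] ++ t
  blocks-tail []      t = refl
  blocks-tail (b ∷ L) t = trans (cong (λ w → zeros (gap b) ++ I ∷ w) (blocks-tail L t))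
                                (sym (++-assoc (zeros (gap b)) (I ∷ blocks L []) t))

  length-block : ∀ b → length (blocks [ b ] []) ≡ suc (gap b)
  length-block b = trans (length-∷ʳ (zeros (gap b)) I) (cong suc (length-replicate (gap b)))

  reverse-blocks : ∀ L t → reverse (blocks L []) ++ I ∷ t ≡ I ∷ blocks (reverse L) t
  reverse-blocks []      t = refl
  reverse-blocks (b ∷ L) t = begin
    reverse (zeros (gap b) ++ I ∷ blocks L []) ++ I ∷ t
      ≡⟨ cong (_++ I ∷ t) (reverse-++ (zeros (gap b)) (I ∷ blocks L [])) ⟩
    (reverse (I ∷ blocks L []) ++ reverse (zeros (gap b))) ++ I ∷ t
      ≡⟨ cong (λ w → (w ++ reverse (zeros (gap b))) ++ I ∷ t) (unfold-reverse I (blocks L [])) ⟩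
    (reverse (blocks L []) ∷ʳ I ++ reverse (zeros (gap b))) ++ I ∷ t
      ≡⟨ ++-assoc (reverse (blocks L []) ∷ʳ I) (reverse (zeros (gap b))) (I ∷ t) ⟩
    reverse (blocks L []) ∷ʳ I ++ (reverse (zeros (gap b)) ++ I ∷ t)
      ≡⟨ ∷ʳ-++ (reverse (blocks L [])) I (reverse (zeros (gap b)) ++ I ∷ t) ⟩
    reverse (blocks L []) ++ I ∷ reverse (zeros (gap b)) ++ I ∷ t
      ≡⟨ cong (λ w → reverse (blocks L []) ++ I ∷ w ++ I ∷ t) (reverse-replicate (gap b) O) ⟩
    reverse (blocks L []) ++ I ∷ blocks [ b ] t
      ≡⟨ reverse-blocks L (blocks [ b ] t) ⟩
    I ∷ blocks (reverse L) (blocks [ b ] t)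
      ≡⟨ cong (I ∷_) (sym (blocks-++ (reverse L) [ b ] t)) ⟩
    I ∷ blocks (reverse L ∷ʳ b) t
      ≡⟨ cong (λ L′ → I ∷ blocks L′ t) (sym (unfold-reverse b L)) ⟩
    I ∷ blocks (reverse (b ∷ L)) t ∎
    where open ≡-Reasoning

  -- What a reading shows beyond its last known block: a 1 within the next
  -- a + 2 letters, or a + 2 zeros.
  data Tail : Word → Set where
    one-within  : ∀ {g} → g < suc (suc a) → Tail (zeros g ++ [ I ])
    none-within : Tail overlong

  ≻-long-run : ∀ k R {T} → Tail T → k ≤ length R →
    blocks R T ≻ blocks (replicate k long) overlong ⊎ (R ≡ replicate k long × T ≡ overlong)
  ≻-long-run zero    []          (one-within g<) _ = inj₁ (zeros-≻-zeros g<)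
  ≻-long-run zero    []          none-within     _ = inj₂ (refl , refl)
  ≻-long-run zero    (b ∷ R)     _               _ = inj₁ (zeros-≻-zeros (gap<2+a b))
  ≻-long-run (suc k) (short ∷ R) _               _ = inj₁ (zeros-≻ (ℕₚ.n<1+n a))
  ≻-long-run (suc k) (long ∷ R)  tail (s≤s k≤R) with ≻-long-run k R tail k≤R
  ... | inj₁ R≻          = inj₁ (≻-++ (zeros (suc a)) (there R≻))
  ... | inj₂ (refl , eq) = inj₂ (refl , eq)

  ≻-short-run : ∀ {g} → g < a → ∀ k R {T} → Tail T → k ≤ length R →
    blocks (replicate k short) (zeros g ++ [ I ]) ≻ blocks R T ⊎
    (R ≡ replicate k short × ∃ λ g′ → g′ ≤ g × T ≡ zeros g′ ++ [ I ])
  ≻-short-run {g} _ zero [] (one-within {g′} _) _ with ℕₚ.≤-<-connex g′ g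
  ... | inj₁ g′≤g = inj₂ (refl , g′ , g′≤g , refl)
  ... | inj₂ g<g′ = inj₁ (zeros-≻ g<g′)
  ≻-short-run g<a zero    []          none-within _ =
    inj₁ (zeros-≻-zeros (ℕₚ.m<n⇒m<1+n (ℕₚ.m<n⇒m<1+n g<a)))
  ≻-short-run g<a zero    (short ∷ R) _ _ = inj₁ (zeros-≻ g<a)
  ≻-short-run g<a zero    (long ∷ R)  _ _ = inj₁ (zeros-≻ (ℕₚ.m<n⇒m<1+n g<a))
  ≻-short-run g<a (suc k) (long ∷ R)  _ _ = inj₁ (zeros-≻ (ℕₚ.n<1+n a))
  ≻-short-run g<a (suc k) (short ∷ R) tail (s≤s k≤R) with ≻-short-run g<a k R tail k≤R
  ... | inj₁ ≻R            = inj₁ (≻-++ (zeros a) (there ≻R))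
  ... | inj₂ (refl , rest) = inj₂ (refl , rest)

  longer-long-run-≻ : ∀ {j k} → j < k → blocks (replicate k long) w ≻ blocks (replicate j long) overlong
  longer-long-run-≻ {j = zero}  {suc k} _         = zeros-≻-zeros (ℕₚ.n<1+n (suc a))
  longer-long-run-≻ {j = suc j} {suc k} (s≤s j<k) = ≻-++ (zeros (suc a)) (there (longer-long-run-≻ j<k))

  shorter-short-run-≻ : ∀ {g j k} → g < a → j < k →
    blocks (replicate j short) (zeros g ++ [ I ]) ≻ blocks (replicate k short) w
  shorter-short-run-≻ {j = zero}  {suc k} g<a _         = zeros-≻ g<a
  shorter-short-run-≻ {j = suc j} {suc k} g<a (s≤s j<k) =
    ≻-++ (zeros a) (there (shorter-short-run-≻ g<a j<k))

  reads-blocks-∷ : ∀ b L → Reads x d i (I ∷ blocks (b ∷ L) t) →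
    Reads x d i (I ∷ blocks [ b ] []) × Reads x d (shift d (suc (gap b)) i) (I ∷ blocks L t)
  reads-blocks-∷ {d = d} {i = i} b L (e ∷ r) with reads-++⁻ (zeros (gap b)) r
  ... | zs , rest = e ∷ reads-++⁺ (zeros (gap b)) zs (head rest ∷ []) ,
                    reads-resp (cong (λ n → shift d n (i + step d)) (length-replicate (gap b))) rest

  reads-blocks-tail : ∀ L → Reads x d i (I ∷ blocks L []) →
    Reads x d (shift d (suc (length (blocks L []))) i) t → Reads x d i (I ∷ blocks L t)
  reads-blocks-tail {x = x} {d = d} {i = i} L r r′ =
    subst (λ w → Reads x d i (I ∷ w)) (sym (blocks-tail L _)) (reads-++⁺ (I ∷ blocks L []) r r′)

  pivot : ∀ A B {A′} → reverse A ≡ A′ → Reads x d q (I ∷ blocks (A ++ B) t) → Reads x (opposite d) q (I ∷ v) →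
    ∃ λ j → Reads x d j (I ∷ blocks B t) × Reads x (opposite d) j (I ∷ blocks A′ v)
  pivot {x = x} {d = d} {q = q} {t = t} {v = v} A B refl known new =
    p , head reversed ∷ reads-resp (shift-suc d n q) (proj₂ split) , reversed
    where
    n : ℕ
    n = length (blocks A [])
    p : ℤ
    p = shift d n q
    split : Reads x d q (I ∷ blocks A []) × Reads x d (shift d (suc n) q) (blocks B t)
    split = reads-++⁻ (I ∷ blocks A [])
              (subst (λ w → Reads x d q (I ∷ w)) (trans (blocks-++ A B t) (blocks-tail A _)) known)
    reversed : Reads x (opposite d) p (I ∷ blocks (reverse A) v)
    reversed = subst (Reads x (opposite d) p) (reverse-blocks A v) (splice (blocks A []) (proj₁ split) new)

  reads-across : ∀ N F → Reads x d j (I ∷ blocks N []) → Reads x (opposite d) j (I ∷ blocks F []) →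
    Reads x d (shift (opposite d) (length (blocks F [])) j) (I ∷ blocks (reverse F ++ N) [])
  reads-across {x = x} {d = d} N F near far =
    subst (Reads x d _) (trans (reverse-blocks F (blocks N [])) (cong (I ∷_) (sym (blocks-++ (reverse F) N []))))
      (splice′ (blocks F []) far near)

  reads-blocks-∷ʳ : ∀ L {b} → Reads x d j (I ∷ blocks L []) →
    Reads x d (shift d (length (blocks L [])) j) (I ∷ blocks [ b ] []) → Reads x d j (I ∷ blocks (L ∷ʳ b) [])
  reads-blocks-∷ʳ {x = x} {d = d} {j = j} L {b} r (_ ∷ r′) =
    subst (λ w → Reads x d j (I ∷ w)) (sym (blocks-++ L [ b ] []))
      (reads-blocks-tail L r (reads-resp (sym (shift-suc d (length (blocks L [])) j)) r′))

  module _ {x : BiWord} (xf : InXF x) where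

    ¬short-then-long-run : ∀ k → Reads x d j (I ∷ blocks (replicate k long) overlong) →
      ¬ Reads x (opposite d) j (I ∷ blocks (short ∷ replicate (suc k) long) overlong)
    ¬short-then-long-run zero    known new = forbidden′ xf new known (zeros-≻-zeros (ℕₚ.n<1+n a))
    ¬short-then-long-run (suc k) known new =
      forbidden′ xf new known (≻-++ (zeros a) (there (longer-long-run-≻ (s≤s (ℕₚ.n≤1+n k)))))

    ¬gap≥2+a : ∀ {L T} → EarlyChange L → Tail T →
      Reads x d q (I ∷ blocks L T) → ¬ Reads x (opposite d) q (I ∷ overlong)
    ¬gap≥2+a (short , _ , _ , refl , _) _ known new = forbidden xf known new (zeros-≻-zeros (ℕₚ.n<1+n a))
    ¬gap≥2+a (long , k , R , refl , k≤R) tail known new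
      with pivot (replicate (suc k) long) (short ∷ R) (reverse-replicate (suc k) long) known new
    ... | _ , known₁ , new₁ with ≻-long-run k R tail k≤R
    ...   | inj₁ R≻ = forbidden xf known₁ new₁ (≻-++ (zeros a) (there R≻))
    ...   | inj₂ (refl , refl) with pivot [ short ] R refl known₁ new₁
    ...     | _ , known₂ , new₂ = ¬short-then-long-run k known₂ new₂

    ¬gap<a : ∀ {L T g} → EarlyChange L → g < a → Tail T →
      Reads x d q (I ∷ blocks L T) → ¬ Reads x (opposite d) q (I ∷ zeros g ++ [ I ])
    ¬gap<a (long , _ , _ , refl , _) g<a _ known new = forbidden′ xf new known (zeros-≻ g<a)
    ¬gap<a (short , k , R , refl , k≤R) g<a tail known new
      with pivot (replicate (suc k) short) (long ∷ R) (reverse-replicate (suc k) short) known new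
    ... | _ , known₁ , new₁ with ≻-short-run g<a k R tail k≤R
    ...   | inj₁ ≻R = forbidden′ xf new₁ known₁ (≻-++ (zeros a) (there ≻R))
    ...   | inj₂ (refl , g′ , g′≤g , refl) with pivot [ long ] R refl known₁ new₁
    ...     | _ , known₂ , new₂ =
      forbidden xf known₂ new₂ (shorter-short-run-≻ (ℕₚ.≤-<-trans g′≤g g<a) (s≤s (ℕₚ.n≤1+n k)))

    with-tail : ∀ {L} → Reads x d q (I ∷ blocks L []) → ∃ λ T → Tail T × Reads x d q (I ∷ blocks L T)
    with-tail {d = d} {q = q} {L = L} known
      with scan-zeros x d (suc (suc a)) (shift d (suc (length (blocks L []))) q)
    ... | inj₁ (_ , g< , r) = _ , one-within g< , reads-blocks-tail L known r
    ... | inj₂ r            = _ , none-within , reads-blocks-tail L known r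

    extend : ∀ {L} → EarlyChange L → Reads x d q (I ∷ blocks L []) →
      ∃ λ b → Reads x (opposite d) q (I ∷ blocks [ b ] [])
    extend {d = d} {q = q} {L} change known
      with with-tail {L = L} known | scan-zeros x (opposite d) (suc (suc a)) (q + step (opposite d))
    ... | _ , tail , known′ | inj₂ r = ⊥-elim (¬gap≥2+a change tail known′ (head known ∷ r))
    ... | _ , tail , known′ | inj₁ (g , g<2+a , r) with ℕₚ.<-cmp g a
    ...   | tri< g<a _ _ = ⊥-elim (¬gap<a change g<a tail known′ (head known ∷ r))
    ...   | tri≈ _ refl _ = short , head known ∷ r
    ...   | tri> _ _ a<g with ℕₚ.≤-antisym (ℕₚ.≤-pred g<2+a) a<g
    ...     | refl = long , head known ∷ r

    grow : ∀ {b b′ near far} → b′ ≢ b → length far ≤ length near →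
      Reads x d j (I ∷ blocks (b ∷ near) []) → Reads x (opposite d) j (I ∷ blocks (b′ ∷ far) []) →
      ∃ λ b″ → Reads x (opposite d) j (I ∷ blocks (b′ ∷ far ∷ʳ b″) [])
    grow {b = b} {b′} {near} {far} b′≢b far≤near near-side far-side =
      map₂ (reads-blocks-∷ʳ (b′ ∷ far) far-side) (extend change (reads-across (b ∷ near) (b′ ∷ far) near-side far-side))
      where
      change : EarlyChange (reverse (b′ ∷ far) ++ b ∷ near)
      change = subst EarlyChange
        (sym (trans (cong (_++ b ∷ near) (unfold-reverse b′ far)) (∷ʳ-++ (reverse far) b′ (b ∷ near))))
        (earlyChange (reverse far) near b′≢b (subst (_≤ length near) (sym (length-reverse far)) far≤near))

  module Orbit (x : BiWord) where

    hop-length : Letter → ℕ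
    hop-length I = suc a
    hop-length O = suc (suc a)

    hop : Direction → ℤ → ℤ
    hop d i = shift d (hop-length (x (shift d (suc a) i))) i

    hops : Direction → ℕ → ℤ → ℤ
    hops d zero    i = i
    hops d (suc k) i = hops d k (hop d i)

    hops-suc : ∀ d k i → hops d (suc k) i ≡ hop d (hops d k i)
    hops-suc d zero    i = refl
    hops-suc d (suc k) i = hops-suc d k (hop d i)

    hop-block : ∀ {b} → Reads x d i (I ∷ blocks [ b ] []) → hop d i ≡ shift d (suc (gap b)) i
    hop-block {d = d} {i = i} {short} (_ ∷ r) =
      cong (λ c → shift d (hop-length c) i)
        (subst (λ n → x (shift d n (i + step d)) ≡ I) (length-replicate a) (reads-at (zeros a) r))
    hop-block {d = d} {i = i} {long} (_ ∷ r) =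
      cong (λ c → shift d (hop-length c) i)
        (subst (λ n → x (shift d n (i + step d)) ≡ O) (length-replicate a)
          (reads-at (zeros a) (subst (Reads x d _) (sym (replicate-∷ʳ a O)) (reads-prefix (zeros (suc a)) r))))

    hop-rightward : ∀ {b} → Reads x rightward i (I ∷ blocks [ b ] []) → hop rightward i ≡ i + + suc (gap b)
    hop-rightward {i = i} {b} r = trans (hop-block r) (shift-rightward (suc (gap b)) i)

    orbit : ∀ L → Reads x d i (I ∷ blocks L []) → ∀ k → k < length L →
      ∃ λ b → Reads x d (hops d k i) (I ∷ blocks [ b ] [])
    orbit (b ∷ L) r zero    _         = b , proj₁ (reads-blocks-∷ b L r)
    orbit (b ∷ L) r (suc k) (s≤s k<L) with reads-blocks-∷ b L r
    ... | first , rest = orbit L (reads-resp (sym (hop-block first)) rest) k k<L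

    Tile : ℤ → ℤ → Set
    Tile i j = (OccursAt x i (I ∷ zeros a) × j ≡ i + + suc a) ⊎
               (OccursAt x i (I ∷ zeros (suc a)) × j ≡ i + + suc (suc a))

    tile-rightward : ∀ {b} → Reads x rightward i (I ∷ blocks [ b ] []) → j ≡ i + + suc (gap b) → Tile i j
    tile-rightward {b = short} r eq = inj₁ (reads⇒occursAt (reads-prefix (I ∷ zeros a) r) , eq)
    tile-rightward {b = long}  r eq = inj₂ (reads⇒occursAt (reads-prefix (I ∷ zeros (suc a)) r) , eq)

    tile-leftward : ∀ {b} → Reads x leftward i (I ∷ blocks [ b ] []) → Tile (hop leftward i) i
    tile-leftward {i = i} {b} r = tile-rightward flipped back
      where
      m : ℕ
      m = suc (gap b)
      start : shift leftward (length (blocks [ b ] [])) i ≡ hop leftward i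
      start = trans (cong (λ n → shift leftward n i) (length-block b)) (sym (hop-block r))
      flipped : Reads x rightward (hop leftward i) (I ∷ blocks [ b ] [])
      flipped = reads-resp start (subst (Reads x rightward _) (reverse-blocks [ b ] [])
                  (splice (blocks [ b ] []) r (head r ∷ [])))
      back : i ≡ hop leftward i + + m
      back = begin
        i                                       ≡⟨ sym (shift-opposite leftward m i) ⟩
        shift rightward m (shift leftward m i)  ≡⟨ shift-rightward m (shift leftward m i) ⟩
        shift leftward m i + + m                ≡⟨ cong (λ k → k + + m) (sym (hop-block r)) ⟩
        hop leftward i + + m                    ∎
        where open ≡-Reasoning

  module FromCentre {x : BiWord} (xf : InXF x) {r₀ r₁ : Block} (r₀≢r₁ : r₀ ≢ r₁) {centre : ℤ}
                    (left₀  : Reads x leftward  centre (I ∷ blocks [ r₀ ] []))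
                    (right₀ : Reads x rightward centre (I ∷ blocks [ r₁ ] [])) where
    open Orbit x

    record Window (n : ℕ) : Set where
      field
        lefts rights  : List Block
        length-lefts  : length lefts ≡ n
        length-rights : length rights ≡ n
        reads-left    : Reads x leftward  centre (I ∷ blocks (r₀ ∷ lefts) [])
        reads-right   : Reads x rightward centre (I ∷ blocks (r₁ ∷ rights) [])

    window : ∀ n → Window n
    window zero    = record { lefts = [] ; rights = [] ; length-lefts = refl ; length-rights = refl
                            ; reads-left = left₀ ; reads-right = right₀ }
    window (suc n) = record { lefts = lefts ∷ʳ proj₁ left-step ; rights = rights ∷ʳ proj₁ right-step
                            ; length-lefts  = trans (length-∷ʳ lefts _) (cong suc length-lefts)
                            ; length-rights = trans (length-∷ʳ rights _) (cong suc length-rights)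
                            ; reads-left = proj₂ left-step ; reads-right = proj₂ right-step }
      where
      open Window (window n)
      right-step : ∃ λ b → Reads x rightward centre (I ∷ blocks (r₁ ∷ rights ∷ʳ b) [])
      right-step = grow xf {d = leftward} {near = lefts} {far = rights} (≢-sym r₀≢r₁)
                     (ℕₚ.≤-reflexive (trans length-rights (sym length-lefts))) reads-left reads-right
      left-step : ∃ λ b → Reads x leftward centre (I ∷ blocks (r₀ ∷ lefts ∷ʳ b) [])
      left-step = grow xf {d = rightward} {near = rights ∷ʳ proj₁ right-step} {far = lefts} r₀≢r₁
                    (ℕₚ.≤-trans (ℕₚ.≤-reflexive (trans length-lefts (sym length-rights))) (length-++-≤ˡ rights))
                    (proj₂ right-step) reads-left

    position : ℤ → ℤ
    position (+ k)    = hops rightward k centre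
    position -[1+ k ] = hops leftward (suc k) centre

    position-pred : ∀ k → position (-[1+ k ] + 1ℤ) ≡ hops leftward k centre
    position-pred zero    = refl
    position-pred (suc k) = refl

    block-rightward : ∀ k → ∃ λ b → Reads x rightward (hops rightward k centre) (I ∷ blocks [ b ] [])
    block-rightward k = orbit (r₁ ∷ rights) reads-right k (s≤s (ℕₚ.≤-reflexive (sym length-rights)))
      where open Window (window k)

    block-leftward : ∀ k → ∃ λ b → Reads x leftward (hops leftward k centre) (I ∷ blocks [ b ] [])
    block-leftward k = orbit (r₀ ∷ lefts) reads-left k (s≤s (ℕₚ.≤-reflexive (sym length-lefts)))
      where open Window (window k)

    tiles : ∀ n → Tile (position n) (position (n + 1ℤ))
    tiles (+ k) with block-rightward k
    ... | _ , r = tile-rightward r (begin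
      position (+ k + 1ℤ)            ≡⟨ cong (λ m → hops rightward m centre) (ℕₚ.+-comm k 1) ⟩
      hops rightward (suc k) centre  ≡⟨ hops-suc rightward k centre ⟩
      hop rightward (position (+ k)) ≡⟨ hop-rightward r ⟩
      position (+ k) + + _           ∎)
      where open ≡-Reasoning
    tiles -[1+ k ] = subst₂ Tile (sym (hops-suc leftward k centre)) (sym (position-pred k))
                       (tile-leftward (proj₂ (block-leftward k)))

  tiling : ∀ {x r₀ r₁ i} → InXF x → r₀ ≢ r₁ → Reads x rightward i (I ∷ blocks (r₀ ∷ r₁ ∷ []) []) →
    IsConcatOfBlocks a x
  tiling {r₀ = r₀} {r₁} xf r₀≢r₁ factor with pivot [ r₀ ] [ r₁ ] refl factor (head factor ∷ [])
  ... | _ , right₀ , left₀ = position , tiles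
    where open FromCentre xf r₀≢r₁ left₀ right₀

lemma5p4 : (a : ℕ) (x : BiWord) → InXF x →
    (IsFactor (I ∷ zeros a ++ I ∷ zeros (suc a) ++ [ I ]) x ⊎
     IsFactor (I ∷ zeros (suc a) ++ I ∷ zeros a ++ [ I ]) x) →
    IsConcatOfBlocks a x
lemma5p4 a x xf (inj₁ (_ , factor)) = Tiling.tiling a {r₀ = short} {long}  xf (λ ()) (occursAt⇒reads x _ factor)
lemma5p4 a x xf (inj₂ (_ , factor)) = Tiling.tiling a {r₀ = long}  {short} xf (λ ()) (occursAt⇒reads x _ factor)
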